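{- Let $\mathbb Q\in\{\exists,\forall\}^*$ be an arbitrary quantifier prefix and let $\overline{\mathbb Q}$ be the prefix obtained from $\mathbb Q$ by replacing every $\exists$ by $\forall$ and every $\forall$ by $\exists$. A query can be maintained in $\mathrm{Dyn}\mathbb Q\mathrm{FO}$ if and only if it can be maintained in $\mathrm{Dyn}\overline{\mathbb Q}\mathrm{FO}$.
   Context: Dynamic complexity setting. A dynamic schema is a pair $(\tau_{in},\tau_{aux})$ of disjoint finite relational schemas; $\tau=\tau_{in}\cup\tau_{aux}$. A modification is $\mathrm{ins}_S(\vec a)$ or $\mathrm{del}_S(\vec a)$ for $S\in\tau_{in}$ and a tuple $\vec a$ of the arity of $S$. An update program assigns to every $R\in\tau_{aux}$ and every $\delta\in\{\mathrm{ins}_S,\mathrm{del}_S : S\in\tau_{in}\}$ a first-order formula $\phi^R_\delta(\vec u;\vec x)$ over $\tau$ (with equality), $|\vec u|$ = arity of $S$, $|\vec x|$ = arity of $R$. A state is $(D,\mathcal I,\mathcal A)$ with finite domain $D$, a $\tau_{in}$-database $\mathcal I$ and a $\tau_{aux}$-database $\mathcal A$ over $D$. Applying $\delta(\vec a)$ to a state $\mathcal S$ gives $(D,\delta(\mathcal I),\mathcal A')$ where $R^{\mathcal A'}=\{\vec b:\mathcal S\models\phi^R_\delta(\vec a;\vec b)\}$. A dynamic program is $(P,\mathrm{Init},Q)$ with $P$ an update program, $\mathrm{Init}$ an arbitrary mapping from $\tau_{in}$-databases to $\tau_{aux}$-databases over the same domain, and $Q\in\tau_{aux}$. It maintains a query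 $\mathcal Q$ if for every $\tau_{in}$-database $\mathcal D$ with domain $D$ and every finite modification sequence $\alpha$, $\mathcal Q(\alpha(\mathcal D))$ equals the interpretation of $Q$ in the state obtained from $(D,\mathcal D,\mathrm{Init}(\mathcal D))$ by applying $\alpha$. For a class $\mathcal C$ of formulas, $\mathrm{Dyn}\mathcal C$ is the class of queries maintained by some dynamic program all of whose update formulas lie in $\mathcal C$. $\mathbb Q$FO denotes the class of prenex first-order formulas with quantifier prefix $\mathbb Q$ (arbitrary quantifier-free matrix); a formula whose prefix is a substring of $\mathbb Q$ is regarded as expressible in $\mathbb Q$FO. -}

module Defs where

open import Data.Nat using (ℕ; zero; suc; _+_)
open import Data.Fin using (Fin)
import Data.Fin as Fin
open import Data.Bool using (Bool; true; false; not; _∧_; _∨_; if_then_else_)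
open import Data.List using (List; []; _∷_; _++_; length; lookup; allFin; foldl)
open import Data.Bool.ListAction using (any; all)
open import Data.Vec using (Vec) renaming (lookup to vlookup; _∷_ to _∷ᵛ_; _++_ to _++ᵛ_; map to vmap)
open import Data.Vec.Properties using (≡-dec)
open import Data.Product using (Σ; _×_; _,_; proj₁; proj₂; ∃)
open import Relation.Nullary using (does)
open import Relation.Binary.PropositionalEquality using (_≡_; subst)

Schema : Set
Schema = List ℕ

Sym : Schema → Set
Sym σ = Fin (length σ)

arity : (σ : Schema) → Sym σ → ℕ
arity σ R = lookup σ R

-- Domains are finite; w.l.o.g. D = Fin n.
Tuple : ℕ → ℕ → Set
Tuple n k = Vec (Fin n) k

Relation : ℕ → ℕ → Set
Relation n k = Tuple n k → Bool

Database : Schema → ℕ → Set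
Database σ n = (R : Sym σ) → Relation n (arity σ R)

data QF (σin σaux : Schema) (m : ℕ) : Set where
  tt    : QF σin σaux m
  atomIn  : (S : Sym σin)  → Vec (Fin m) (arity σin S)  → QF σin σaux m
  atomAux : (R : Sym σaux) → Vec (Fin m) (arity σaux R) → QF σin σaux m
  eq    : Fin m → Fin m → QF σin σaux m
  neg   : QF σin σaux m → QF σin σaux m
  conj  : QF σin σaux m → QF σin σaux m → QF σin σaux m
  disj  : QF σin σaux m → QF σin σaux m → QF σin σaux m

data Quant : Set where
  ∃q ∀q : Quant

-- Prenex formulas with quantifier prefix qs and m free variables.
-- The innermost-bound variable is Fin.zero.
data Prenex (σin σaux : Schema) : List Quant → ℕ → Set where
  matrix : ∀ {m} → QF σin σaux m → Prenex σin σaux [] m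
  exists : ∀ {qs m} → Prenex σin σaux qs (suc m) → Prenex σin σaux (∃q ∷ qs) m
  forAll : ∀ {qs m} → Prenex σin σaux qs (suc m) → Prenex σin σaux (∀q ∷ qs) m

Formula : Schema → Schema → ℕ → Set
Formula σin σaux m = Σ (List Quant) (λ qs → Prenex σin σaux qs m)

prefixOf : ∀ {σin σaux m} → Formula σin σaux m → List Quant
prefixOf = proj₁

evalQF : ∀ {σin σaux m n} → Database σin n → Database σaux n →
         QF σin σaux m → Vec (Fin n) m → Bool
evalQF I A tt          ρ = true
evalQF I A (atomIn S ts)  ρ = I S (vmap (vlookup ρ) ts)
evalQF I A (atomAux R ts) ρ = A R (vmap (vlookup ρ) ts)
evalQF I A (eq i j)    ρ = does (vlookup ρ i Fin.≟ vlookup ρ j)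
evalQF I A (neg φ)     ρ = not (evalQF I A φ ρ)
evalQF I A (conj φ ψ)  ρ = evalQF I A φ ρ ∧ evalQF I A ψ ρ
evalQF I A (disj φ ψ)  ρ = evalQF I A φ ρ ∨ evalQF I A ψ ρ

evalP : ∀ {σin σaux qs m n} → Database σin n → Database σaux n →
        Prenex σin σaux qs m → Vec (Fin n) m → Bool
evalP I A (matrix φ) ρ = evalQF I A φ ρ
evalP {n = n} I A (exists φ) ρ = any (λ d → evalP I A φ (d ∷ᵛ ρ)) (allFin n)
evalP {n = n} I A (forAll φ) ρ = all (λ d → evalP I A φ (d ∷ᵛ ρ)) (allFin n)

eval : ∀ {σin σaux m n} → Database σin n → Database σaux n →
       Formula σin σaux m → Vec (Fin n) m → Bool
eval I A (_ , φ) ρ = evalP I A φ ρ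

data ModKind : Set where
  insK delK : ModKind

record Modification (σin : Schema) (n : ℕ) : Set where
  constructor mod
  field
    kind  : ModKind
    sym   : Sym σin
    tuple : Tuple n (arity σin sym)

applyMod : ∀ {σin n} → Modification σin n → Database σin n → Database σin n
applyMod {σin} (mod k S a) I R b with R Fin.≟ S
... | Relation.Nullary.no _ = I R b
... | Relation.Nullary.yes Relation.Binary.PropositionalEquality.refl =
  if does (≡-dec Fin._≟_ a b)
  then (insOrDel k)
  else I S b
  where
    insOrDel : ModKind → Bool
    insOrDel insK = true
    insOrDel delK = false

applyMods : ∀ {σin n} → List (Modification σin n) → Database σin n → Database σin n
applyMods []       I = I
applyMods (δ ∷ α)  I = applyMods α (applyMod δ I)

-- φ^R_δ(u⃗; x⃗) with |u⃗| = arity of S and |x⃗| = arity of R;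
-- the environment is u⃗ ++ x⃗.
UpdateProgram : Schema → Schema → Set
UpdateProgram σin σaux =
  (R : Sym σaux) → ModKind → (S : Sym σin) →
  Formula σin σaux (arity σin S + arity σaux R)

State : Schema → Schema → ℕ → Set
State σin σaux n = Database σin n × Database σaux n

step : ∀ {σin σaux n} → UpdateProgram σin σaux →
       Modification σin n → State σin σaux n → State σin σaux n
step P δ@(mod k S a) (I , A) =
  applyMod δ I , (λ R b → eval I A (P R k S) (a ++ᵛ b))

run : ∀ {σin σaux n} → UpdateProgram σin σaux →
      List (Modification σin n) → State σin σaux n → State σin σaux n
run P []      s = s
run P (δ ∷ α) s = run P α (step P δ s)

Query : Schema → ℕ → Set
Query σin k = ∀ n → Database σin n → Relation n k

record DynProgram (σin σaux : Schema) (k : ℕ) : Set where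
  field
    program : UpdateProgram σin σaux
    init    : ∀ n → Database σin n → Database σaux n
    qsym    : Sym σaux
    qarity  : arity σaux qsym ≡ k

Maintains : ∀ {σin σaux k} → DynProgram σin σaux k → Query σin k → Set
Maintains {σin} {σaux} {k} 𝒫 𝒬 =
  ∀ n (D : Database σin n) (α : List (Modification σin n)) (t : Tuple n k) →
    𝒬 n (applyMods α D) t
      ≡ proj₂ (run program α (D , init n D)) qsym
          (subst (Tuple n) (Relation.Binary.PropositionalEquality.sym qarity) t)
  where open DynProgram 𝒫

Substring : List Quant → List Quant → Set
Substring qs Q = ∃ λ pre → ∃ λ suf → Q ≡ pre ++ qs ++ suf

DynQFO : List Quant → ∀ σin {k} → Query σin k → Set
DynQFO Q σin {k} 𝒬 =
  Σ Schema λ σaux → Σ (DynProgram σin σaux k) λ 𝒫 →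
    (∀ R κ S → Substring (prefixOf (DynProgram.program 𝒫 R κ S)) Q)
    × Maintains 𝒫 𝒬

flip : Quant → Quant
flip ∃q = ∀q
flip ∀q = ∃q

dualPrefix : List Quant → List Quant
dualPrefix = Data.List.map flip

-- The update formulas of a program with prefix 𝐐 can be traded for formulas with the
-- dual prefix by storing, besides each auxiliary relation R, the negation ¬φ^R_δ of every
-- update formula, evaluated in the current state. After a modification δ(a) the new value
-- of R is φ^R_δ(a, x), i.e. the negation of a stored atom, and the new value of a stored
-- ¬φ is ¬φ evaluated in the new state. The new input database is quantifier-free definable
-- from the old one and a, and the new auxiliary relations from the stored negations, so
-- substituting these definitions into φ and pushing the negation through the quantifier
-- prefix yields a formula with prefix 𝐐̄. Applying the construction twice gives the converse.
module Submission where

open import Defs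
open import Data.Bool using (Bool; true; false; not; _∧_; _∨_; if_then_else_)
open import Data.Bool.ListAction using (any; all; and; or)
open import Data.Bool.Properties using (not-involutive; ∨-∧-booleanAlgebra)
open import Algebra.Lattice.Properties.BooleanAlgebra ∨-∧-booleanAlgebra using (deMorgan₁; deMorgan₂)
open import Data.Fin using (Fin; zero; suc; _↑ˡ_; _↑ʳ_)
import Data.Fin as Fin
import Data.Fin.Properties as Fin
open import Data.List using (List; []; _∷_; _++_; length; allFin; cartesianProduct)
  renaming (map to lmap)
import Data.List.Properties as List
open import Data.List.Membership.Propositional using (_∈_)
open import Data.List.Membership.Propositional.Properties
  using (∈-allFin; ∈-map⁺; ∈-++⁺ˡ; ∈-++⁺ʳ; ∈-cartesianProduct⁺)
open import Data.List.Relation.Unary.Any using (here; there)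
open import Data.Nat using (ℕ; suc; _+_)
open import Data.Product using (_×_; _,_; proj₁; proj₂)
open import Data.Sum using (_⊎_; inj₁; inj₂)
open import Data.Vec using (Vec; []; _∷_; cast; tabulate)
  renaming (lookup to vlookup; _++_ to _++ᵛ_; map to vmap)
import Data.Vec.Properties as Vec
open import Function using (_∘_)
open import Function.Bundles using (_⇔_; mk⇔)
open import Relation.Binary.PropositionalEquality
open import Relation.Nullary using (yes; no; does)

flip-involutive : ∀ q → flip (flip q) ≡ q
flip-involutive ∃q = refl
flip-involutive ∀q = refl

dualPrefix-involutive : ∀ qs → dualPrefix (dualPrefix qs) ≡ qs
dualPrefix-involutive qs =
  trans (sym (List.map-∘ qs)) (trans (List.map-cong flip-involutive qs) (List.map-id qs))

Substring-dual : ∀ {qs Q} → Substring qs Q → Substring (dualPrefix qs) (dualPrefix Q)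
Substring-dual {qs} (pre , suf , refl) =
  dualPrefix pre , dualPrefix suf ,
  trans (List.map-++ flip pre (qs ++ suf)) (cong (dualPrefix pre ++_) (List.map-++ flip qs suf))

module _ {A : Set} where

  any-cong : {f g : A → Bool} → f ≗ g → ∀ xs → any f xs ≡ any g xs
  any-cong f≗g xs = cong or (List.map-cong f≗g xs)

  all-cong : {f g : A → Bool} → f ≗ g → ∀ xs → all f xs ≡ all g xs
  all-cong f≗g xs = cong and (List.map-cong f≗g xs)

  all-not : ∀ (g : A → Bool) xs → all (not ∘ g) xs ≡ not (any g xs)
  all-not g []       = refl
  all-not g (x ∷ xs) =
    trans (cong (not (g x) ∧_) (all-not g xs)) (sym (deMorgan₂ (g x) (any g xs)))

  any-not : ∀ (g : A → Bool) xs → any (not ∘ g) xs ≡ not (all g xs)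
  any-not g []       = refl
  any-not g (x ∷ xs) =
    trans (cong (not (g x) ∨_) (any-not g xs)) (sym (deMorgan₁ (g x) (all g xs)))

∨-as-if : ∀ b x → b ∨ x ≡ (if b then true else x)
∨-as-if true  x = refl
∨-as-if false x = refl

not-∧-as-if : ∀ b x → not b ∧ x ≡ (if b then false else x)
not-∧-as-if true  x = refl
not-∧-as-if false x = refl

lift : ∀ {m m'} → (Fin m → Fin m') → Fin (suc m) → Fin (suc m')
lift r zero    = zero
lift r (suc i) = suc (r i)

module _ {A : Set} where

  lookup-lift : ∀ {m m'} (ρ : Vec A m) (ρ' : Vec A m') {r : Fin m → Fin m'} (d : A) →
                vlookup ρ' ∘ r ≗ vlookup ρ → vlookup (d ∷ ρ') ∘ lift r ≗ vlookup (d ∷ ρ)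
  lookup-lift ρ ρ' d h zero    = refl
  lookup-lift ρ ρ' d h (suc i) = h i

  map-lookup-map : ∀ {m m' j} (ρ : Vec A m) (ρ' : Vec A m') {r : Fin m → Fin m'} →
                   vlookup ρ' ∘ r ≗ vlookup ρ → (ts : Vec (Fin m) j) →
                   vmap (vlookup ρ') (vmap r ts) ≡ vmap (vlookup ρ) ts
  map-lookup-map ρ ρ' {r} h ts = trans (sym (Vec.map-∘ (vlookup ρ') r ts)) (Vec.map-cong h ts)

  map-lookup-suc : ∀ {m j} (d : A) (ρ : Vec A m) (ps : Vec (Fin m) j) →
                   vmap (vlookup (d ∷ ρ)) (vmap suc ps) ≡ vmap (vlookup ρ) ps
  map-lookup-suc d ρ ps = sym (Vec.map-∘ (vlookup (d ∷ ρ)) suc ps)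

  map-lookup-tabulate : ∀ {m j} (ρ : Vec A m) {f : Fin j → Fin m} {xs : Vec A j} →
                        vlookup ρ ∘ f ≗ vlookup xs → vmap (vlookup ρ) (tabulate f) ≡ xs
  map-lookup-tabulate ρ {f} {xs} h =
    trans (sym (Vec.tabulate-∘ (vlookup ρ) f))
          (trans (Vec.tabulate-cong h) (Vec.tabulate∘lookup xs))

cast-subst : ∀ {A : Set} {l m k} (e₁ : l ≡ m) (e₂ : l ≡ k) (xs : Vec A k) →
             cast e₁ (subst (Vec A) (sym e₂) xs) ≡ subst (Vec A) (sym (trans (sym e₁) e₂)) xs
cast-subst refl refl xs = Vec.cast-is-id refl xs

params : ∀ p r → Vec (Fin (p + r)) p
params p r = tabulate (_↑ˡ r)

shift : ∀ p {l r} → l ≡ r → Fin l → Fin (p + r)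
shift p e i = p ↑ʳ Fin.cast e i

module _ {A : Set} {p r : ℕ} (a : Vec A p) (b : Vec A r) where

  map-lookup-params : vmap (vlookup (a ++ᵛ b)) (params p r) ≡ a
  map-lookup-params = map-lookup-tabulate (a ++ᵛ b) (Vec.lookup-++ˡ a b)

  lookup-shift : vlookup (a ++ᵛ b) ∘ shift p refl ≗ vlookup b
  lookup-shift i =
    trans (cong (vlookup (a ++ᵛ b) ∘ (p ↑ʳ_)) (Fin.cast-is-id refl i)) (Vec.lookup-++ʳ a b i)

module _ {σin σaux : Schema} where

  renameQF : ∀ {m m'} → (Fin m → Fin m') → QF σin σaux m → QF σin σaux m'
  renameQF r tt             = tt
  renameQF r (atomIn S ts)  = atomIn S (vmap r ts)
  renameQF r (atomAux R ts) = atomAux R (vmap r ts)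
  renameQF r (eq i j)       = eq (r i) (r j)
  renameQF r (neg φ)        = neg (renameQF r φ)
  renameQF r (conj φ ψ)     = conj (renameQF r φ) (renameQF r ψ)
  renameQF r (disj φ ψ)     = disj (renameQF r φ) (renameQF r ψ)

  renameP : ∀ {qs m m'} → (Fin m → Fin m') → Prenex σin σaux qs m → Prenex σin σaux qs m'
  renameP r (matrix φ) = matrix (renameQF r φ)
  renameP r (exists φ) = exists (renameP (lift r) φ)
  renameP r (forAll φ) = forAll (renameP (lift r) φ)

  negateP : ∀ {qs m} → Prenex σin σaux qs m → Prenex σin σaux (dualPrefix qs) m
  negateP (matrix φ) = matrix (neg φ)
  negateP (exists φ) = forAll (negateP φ)
  negateP (forAll φ) = exists (negateP φ)

  module _ {n} (I : Database σin n) (A : Database σaux n) where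

    evalQF-rename : ∀ {m m'} (φ : QF σin σaux m) (ρ : Vec (Fin n) m) (ρ' : Vec (Fin n) m')
                    {r : Fin m → Fin m'} → vlookup ρ' ∘ r ≗ vlookup ρ →
                    evalQF I A (renameQF r φ) ρ' ≡ evalQF I A φ ρ
    evalQF-rename tt             ρ ρ' h = refl
    evalQF-rename (atomIn S ts)  ρ ρ' h = cong (I S) (map-lookup-map ρ ρ' h ts)
    evalQF-rename (atomAux R ts) ρ ρ' h = cong (A R) (map-lookup-map ρ ρ' h ts)
    evalQF-rename (eq i j)       ρ ρ' h = cong₂ (λ x y → does (x Fin.≟ y)) (h i) (h j)
    evalQF-rename (neg φ)        ρ ρ' h = cong not (evalQF-rename φ ρ ρ' h)
    evalQF-rename (conj φ ψ)     ρ ρ' h = cong₂ _∧_ (evalQF-rename φ ρ ρ' h) (evalQF-rename ψ ρ ρ' h)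
    evalQF-rename (disj φ ψ)     ρ ρ' h = cong₂ _∨_ (evalQF-rename φ ρ ρ' h) (evalQF-rename ψ ρ ρ' h)

    evalP-rename : ∀ {qs m m'} (φ : Prenex σin σaux qs m) (ρ : Vec (Fin n) m) (ρ' : Vec (Fin n) m')
                   {r : Fin m → Fin m'} → vlookup ρ' ∘ r ≗ vlookup ρ →
                   evalP I A (renameP r φ) ρ' ≡ evalP I A φ ρ
    evalP-rename (matrix φ) ρ ρ' h = evalQF-rename φ ρ ρ' h
    evalP-rename (exists φ) ρ ρ' h =
      any-cong (λ d → evalP-rename φ (d ∷ ρ) (d ∷ ρ') (lookup-lift ρ ρ' d h)) (allFin n)
    evalP-rename (forAll φ) ρ ρ' h =
      all-cong (λ d → evalP-rename φ (d ∷ ρ) (d ∷ ρ') (lookup-lift ρ ρ' d h)) (allFin n)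

    evalP-negate : ∀ {qs m} (φ : Prenex σin σaux qs m) (ρ : Vec (Fin n) m) →
                   evalP I A (negateP φ) ρ ≡ not (evalP I A φ ρ)
    evalP-negate (matrix φ) ρ = refl
    evalP-negate (exists φ) ρ =
      trans (all-cong (λ d → evalP-negate φ (d ∷ ρ)) (allFin n))
            (all-not (λ d → evalP I A φ (d ∷ ρ)) (allFin n))
    evalP-negate (forAll φ) ρ =
      trans (any-cong (λ d → evalP-negate φ (d ∷ ρ)) (allFin n))
            (any-not (λ d → evalP I A φ (d ∷ ρ)) (allFin n))

record AtomSubst (p : ℕ) (σin σaux τin τaux : Schema) : Set where
  field
    substIn  : ∀ {m} → Vec (Fin m) p → (S : Sym σin) → Vec (Fin m) (arity σin S) → QF τin τaux m
    substAux : ∀ {m} → Vec (Fin m) p → (R : Sym σaux) → Vec (Fin m) (arity σaux R) → QF τin τaux m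

module _ {p σin σaux τin τaux} (θ : AtomSubst p σin σaux τin τaux) where
  open AtomSubst θ

  substQF : ∀ {m} → Vec (Fin m) p → QF σin σaux m → QF τin τaux m
  substQF ps tt             = tt
  substQF ps (atomIn S ts)  = substIn ps S ts
  substQF ps (atomAux R ts) = substAux ps R ts
  substQF ps (eq i j)       = eq i j
  substQF ps (neg φ)        = neg (substQF ps φ)
  substQF ps (conj φ ψ)     = conj (substQF ps φ) (substQF ps ψ)
  substQF ps (disj φ ψ)     = disj (substQF ps φ) (substQF ps ψ)

  substP : ∀ {qs m} → Vec (Fin m) p → Prenex σin σaux qs m → Prenex τin τaux qs m
  substP ps (matrix φ) = matrix (substQF ps φ)
  substP ps (exists φ) = exists (substP (vmap suc ps) φ)
  substP ps (forAll φ) = forAll (substP (vmap suc ps) φ)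

  Defines : ∀ {n} → Database τin n → Database τaux n → Tuple n p →
            Database σin n → Database σaux n → Set
  Defines {n} J B a I A =
    ∀ {m} (ρ : Vec (Fin n) m) (ps : Vec (Fin m) p) → vmap (vlookup ρ) ps ≡ a →
      (∀ S ts → evalQF J B (substIn ps S ts) ρ ≡ I S (vmap (vlookup ρ) ts))
    × (∀ R ts → evalQF J B (substAux ps R ts) ρ ≡ A R (vmap (vlookup ρ) ts))

  module _ {n} {J : Database τin n} {B : Database τaux n} {a : Tuple n p}
           {I : Database σin n} {A : Database σaux n} (θ-defines : Defines J B a I A) where

    evalQF-subst : ∀ {m} (φ : QF σin σaux m) (ρ : Vec (Fin n) m) (ps : Vec (Fin m) p) →
                   vmap (vlookup ρ) ps ≡ a → evalQF J B (substQF ps φ) ρ ≡ evalQF I A φ ρ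
    evalQF-subst tt             ρ ps h = refl
    evalQF-subst (atomIn S ts)  ρ ps h = proj₁ (θ-defines ρ ps h) S ts
    evalQF-subst (atomAux R ts) ρ ps h = proj₂ (θ-defines ρ ps h) R ts
    evalQF-subst (eq i j)       ρ ps h = refl
    evalQF-subst (neg φ)        ρ ps h = cong not (evalQF-subst φ ρ ps h)
    evalQF-subst (conj φ ψ)     ρ ps h = cong₂ _∧_ (evalQF-subst φ ρ ps h) (evalQF-subst ψ ρ ps h)
    evalQF-subst (disj φ ψ)     ρ ps h = cong₂ _∨_ (evalQF-subst φ ρ ps h) (evalQF-subst ψ ρ ps h)

    evalP-subst : ∀ {qs m} (φ : Prenex σin σaux qs m) (ρ : Vec (Fin n) m) (ps : Vec (Fin m) p) →
                  vmap (vlookup ρ) ps ≡ a → evalP J B (substP ps φ) ρ ≡ evalP I A φ ρ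
    evalP-subst (matrix φ) ρ ps h = evalQF-subst φ ρ ps h
    evalP-subst (exists φ) ρ ps h =
      any-cong (λ d → evalP-subst φ (d ∷ ρ) (vmap suc ps) (trans (map-lookup-suc d ρ ps) h))
               (allFin n)
    evalP-subst (forAll φ) ρ ps h =
      all-cong (λ d → evalP-subst φ (d ∷ ρ) (vmap suc ps) (trans (map-lookup-suc d ρ ps) h))
               (allFin n)

module _ {σin σaux : Schema} where

  eqTuple : ∀ {m j} → Vec (Fin m) j → Vec (Fin m) j → QF σin σaux m
  eqTuple []       []       = tt
  eqTuple (x ∷ xs) (y ∷ ys) = conj (eq x y) (eqTuple xs ys)

  modifiedBy : ∀ {m} → ModKind → QF σin σaux m → QF σin σaux m → QF σin σaux m
  modifiedBy insK e x = disj e x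
  modifiedBy delK e x = conj (neg e) x

  updatedAtom : ∀ {m} → ModKind → (S' : Sym σin) → Vec (Fin m) (arity σin S') →
                (S : Sym σin) → Vec (Fin m) (arity σin S) → QF σin σaux m
  updatedAtom κ S' ps S ts with S Fin.≟ S'
  ... | yes refl = modifiedBy κ (eqTuple ps ts) (atomIn S ts)
  ... | no _     = atomIn S ts

  module _ {n} (I : Database σin n) (A : Database σaux n) where

    evalQF-eqTuple : ∀ {m j} (ρ : Vec (Fin n) m) (xs ys : Vec (Fin m) j) →
                     evalQF I A (eqTuple xs ys) ρ
                       ≡ does (Vec.≡-dec Fin._≟_ (vmap (vlookup ρ) xs) (vmap (vlookup ρ) ys))
    evalQF-eqTuple ρ []       []       = refl
    evalQF-eqTuple ρ (x ∷ xs) (y ∷ ys) =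
      cong (does (vlookup ρ x Fin.≟ vlookup ρ y) ∧_) (evalQF-eqTuple ρ xs ys)

    evalQF-updatedAtom : ∀ {m} κ S' (ρ : Vec (Fin n) m) ps S ts →
                         evalQF I A (updatedAtom κ S' ps S ts) ρ
                           ≡ applyMod {σin} (mod κ S' (vmap (vlookup ρ) ps)) I S (vmap (vlookup ρ) ts)
    evalQF-updatedAtom κ S' ρ ps S ts with S Fin.≟ S'
    evalQF-updatedAtom insK S' ρ ps S ts | yes refl =
      trans (cong (_∨ I S b) (evalQF-eqTuple ρ ps ts))
            (∨-as-if (does (Vec.≡-dec Fin._≟_ a b)) (I S b))
      where a = vmap (vlookup ρ) ps
            b = vmap (vlookup ρ) ts
    evalQF-updatedAtom delK S' ρ ps S ts | yes refl =
      trans (cong (λ e → not e ∧ I S b) (evalQF-eqTuple ρ ps ts))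
            (not-∧-as-if (does (Vec.≡-dec Fin._≟_ a b)) (I S b))
      where a = vmap (vlookup ρ) ps
            b = vmap (vlookup ρ) ts
    ... | no _ = refl

module _ {C : Set} (ar : C → ℕ) where

  decode : (cs : List C) → Sym (lmap ar cs) → C
  decode (c ∷ cs) zero    = c
  decode (c ∷ cs) (suc i) = decode cs i

  encode : ∀ {c cs} → c ∈ cs → Sym (lmap ar cs)
  encode (here refl) = zero
  encode (there c∈cs) = suc (encode c∈cs)

  decode-encode : ∀ {c cs} (c∈cs : c ∈ cs) → decode cs (encode c∈cs) ≡ c
  decode-encode (here refl)  = refl
  decode-encode (there c∈cs) = decode-encode c∈cs

  arity-decode : ∀ cs (R : Sym (lmap ar cs)) → arity (lmap ar cs) R ≡ ar (decode cs R)
  arity-decode (c ∷ cs) zero    = refl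
  arity-decode (c ∷ cs) (suc i) = arity-decode cs i

  arity-encode : ∀ {c cs} (c∈cs : c ∈ cs) → ar c ≡ arity (lmap ar cs) (encode c∈cs)
  arity-encode {cs = cs} c∈cs =
    trans (cong ar (sym (decode-encode c∈cs))) (sym (arity-decode cs (encode c∈cs)))

  Represents : ∀ {n} cs → ((c : C) → Relation n (ar c)) → Database (lmap ar cs) n → Set
  Represents cs V B = ∀ R b → B R b ≡ V (decode cs R) (cast (arity-decode cs R) b)

  represents-encode : ∀ {n cs} {V : (c : C) → Relation n (ar c)} {B} → Represents cs V B →
                      ∀ {c} (c∈cs : c ∈ cs) b → B (encode c∈cs) (cast (arity-encode c∈cs) b) ≡ V c b
  represents-encode {cs = cs} {V} {B} rep c∈cs b =
    at (encode c∈cs) (decode-encode c∈cs) (arity-encode c∈cs) b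
    where
      at : ∀ R {c} → decode cs R ≡ c → (e : ar c ≡ arity (lmap ar cs) R) →
           ∀ b → B R (cast e b) ≡ V c b
      at R refl e b = trans (rep R (cast e b))
                          (cong (V (decode cs R)) (trans (Vec.cast-trans e _ b) (Vec.cast-is-id _ b)))

module DualProgram {σin σaux : Schema} {k : ℕ} (𝒫 : DynProgram σin σaux k) where
  open DynProgram 𝒫

  AuxCode : Set
  AuxCode = Sym σaux ⊎ (Sym σaux × ModKind × Sym σin)

  codeArity : AuxCode → ℕ
  codeArity (inj₁ R)           = arity σaux R
  codeArity (inj₂ (R , κ , S)) = arity σin S + arity σaux R

  modKinds : List ModKind
  modKinds = insK ∷ delK ∷ []

  codes : List AuxCode
  codes = lmap inj₁ (allFin (length σaux)) ++
          lmap inj₂ (cartesianProduct (allFin (length σaux))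
                                      (cartesianProduct modKinds (allFin (length σin))))

  codes-complete : ∀ c → c ∈ codes
  codes-complete (inj₁ R)           = ∈-++⁺ˡ (∈-map⁺ inj₁ (∈-allFin R))
  codes-complete (inj₂ (R , κ , S)) =
    ∈-++⁺ʳ _ (∈-map⁺ inj₂ (∈-cartesianProduct⁺ (∈-allFin R)
                             (∈-cartesianProduct⁺ (∈-modKinds κ) (∈-allFin S))))
    where
      ∈-modKinds : ∀ κ → κ ∈ modKinds
      ∈-modKinds insK = here refl
      ∈-modKinds delK = there (here refl)

  σdual : Schema
  σdual = lmap codeArity codes

  symOf : AuxCode → Sym σdual
  symOf c = encode codeArity (codes-complete c)

  arity-symOf : ∀ c → codeArity c ≡ arity σdual (symOf c)
  arity-symOf c = arity-encode codeArity (codes-complete c)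

  -- The relation coded inj₂ (R, κ, S) stores ¬φ^R_{κ S}; storing the negation is what lets
  -- its update be written with the dual prefix.
  expand : ∀ {n} → Database σin n → Database σaux n → (c : AuxCode) → Relation n (codeArity c)
  expand I A (inj₁ R)           b = A R b
  expand I A (inj₂ (R , κ , S)) b = not (eval I A (program R κ S) b)

  updateSubst : (κ : ModKind) (S : Sym σin) → AtomSubst (arity σin S) σin σaux σin σdual
  updateSubst κ S = record
    { substIn  = updatedAtom κ S
    ; substAux = λ ps R ts → let c = inj₂ (R , κ , S) in
        neg (atomAux (symOf c) (cast (arity-symOf c) (ps ++ᵛ ts)))
    }

  dualFormula : (c : AuxCode) {r : ℕ} → codeArity c ≡ r →
                ModKind → (S : Sym σin) → Formula σin σdual (arity σin S + r)
  dualFormula (inj₁ R) {r} e κ S =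
    [] , matrix (AtomSubst.substAux (updateSubst κ S) (params _ r) R (tabulate (shift _ e)))
  dualFormula (inj₂ (R , κ₀ , S₀)) {r} e κ S =
    dualPrefix (prefixOf φ) ,
    negateP (substP (updateSubst κ S) (params _ r) (renameP (shift _ e) (proj₂ φ)))
    where φ = program R κ₀ S₀

  dualProgram : UpdateProgram σin σdual
  dualProgram R' = dualFormula (decode codeArity codes R') (sym (arity-decode codeArity codes R'))

  dualProgram-prefix : ∀ {Q} → (∀ R κ S → Substring (prefixOf (program R κ S)) Q) →
                       ∀ R' κ S → Substring (prefixOf (dualProgram R' κ S)) (dualPrefix Q)
  dualProgram-prefix {Q} prefixes R' = prefix (decode codeArity codes R')
    where
      prefix : ∀ c {r} {e : codeArity c ≡ r} κ S →
               Substring (prefixOf (dualFormula c e κ S)) (dualPrefix Q)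
      prefix (inj₁ R)           κ S = [] , dualPrefix Q , refl
      prefix (inj₂ (R , κ₀ , S₀)) κ S = Substring-dual (prefixes R κ₀ S₀)

  module _ {n} (I : Database σin n) (A : Database σaux n) (A' : Database σdual n)
           (rep : Represents codeArity codes (expand I A) A')
           (κ : ModKind) (S : Sym σin) (a : Tuple n (arity σin S)) where

    I₁ : Database σin n
    I₁ = applyMod {σin} (mod κ S a) I

    A₁ : Database σaux n
    A₁ R b = eval I A (program R κ S) (a ++ᵛ b)

    updateSubst-defines : Defines (updateSubst κ S) I A' a I₁ A₁
    updateSubst-defines ρ ps ps↦a = updatedIn , updatedAux
      where
        updatedIn : ∀ S' ts → evalQF {σin} {σdual} I A' (updatedAtom κ S ps S' ts) ρ
                                ≡ I₁ S' (vmap (vlookup ρ) ts)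
        updatedIn S' ts =
          trans (evalQF-updatedAtom {σin} {σdual} I A' κ S ρ ps S' ts)
                (cong (λ a' → applyMod {σin} (mod κ S a') I S' (vmap (vlookup ρ) ts)) ps↦a)

        updatedAux : ∀ R ts →
                     evalQF {σin} {σdual} I A' (AtomSubst.substAux (updateSubst κ S) ps R ts) ρ
                       ≡ A₁ R (vmap (vlookup ρ) ts)
        updatedAux R ts = begin
          not (A' (symOf c) (vmap (vlookup ρ) (cast e (ps ++ᵛ ts))))
            ≡⟨ cong (λ v → not (A' (symOf c) v)) (Vec.map-cast (vlookup ρ) e (ps ++ᵛ ts)) ⟩
          not (A' (symOf c) (cast e (vmap (vlookup ρ) (ps ++ᵛ ts))))
            ≡⟨ cong (λ v → not (A' (symOf c) (cast e v))) (Vec.map-++ (vlookup ρ) ps ts) ⟩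
          not (A' (symOf c) (cast e (vmap (vlookup ρ) ps ++ᵛ b)))
            ≡⟨ cong (λ a' → not (A' (symOf c) (cast e (a' ++ᵛ b)))) ps↦a ⟩
          not (A' (symOf c) (cast e (a ++ᵛ b)))
            ≡⟨ cong not (represents-encode codeArity {V = expand I A} {B = A'} rep
                                           (codes-complete c) (a ++ᵛ b)) ⟩
          not (not (A₁ R b))
            ≡⟨ not-involutive (A₁ R b) ⟩
          A₁ R b ∎
          where
            open ≡-Reasoning
            c = inj₂ (R , κ , S)
            e = arity-symOf c
            b = vmap (vlookup ρ) ts

    eval-dualFormula : ∀ c {r} (e : codeArity c ≡ r) (b : Tuple n r) →
                       eval I A' (dualFormula c e κ S) (a ++ᵛ b) ≡ expand I₁ A₁ c (cast (sym e) b)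
    eval-dualFormula (inj₁ R) refl b = begin
      evalQF I A' (AtomSubst.substAux θ ps R (tabulate (shift p refl))) (a ++ᵛ b)
        ≡⟨ proj₂ (updateSubst-defines (a ++ᵛ b) ps (map-lookup-params a b)) R _ ⟩
      A₁ R (vmap (vlookup (a ++ᵛ b)) (tabulate (shift p refl)))
        ≡⟨ cong (A₁ R) (map-lookup-tabulate (a ++ᵛ b) (lookup-shift a b)) ⟩
      A₁ R b
        ≡⟨ cong (A₁ R) (Vec.cast-is-id refl b) ⟨
      A₁ R (cast refl b) ∎
      where
        open ≡-Reasoning
        p = arity σin S
        θ = updateSubst κ S
        ps = params p _
    eval-dualFormula (inj₂ (R , κ₀ , S₀)) refl b = begin
      evalP I A' (negateP (substP θ ps ψ)) (a ++ᵛ b)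
        ≡⟨ evalP-negate I A' (substP θ ps ψ) (a ++ᵛ b) ⟩
      not (evalP I A' (substP θ ps ψ) (a ++ᵛ b))
        ≡⟨ cong not (evalP-subst θ {I = I₁} {A = A₁} updateSubst-defines ψ (a ++ᵛ b) ps
                                 (map-lookup-params a b)) ⟩
      not (evalP I₁ A₁ ψ (a ++ᵛ b))
        ≡⟨ cong not (evalP-rename I₁ A₁ φ b (a ++ᵛ b) (lookup-shift a b)) ⟩
      not (evalP I₁ A₁ φ b)
        ≡⟨ cong (not ∘ evalP I₁ A₁ φ) (Vec.cast-is-id refl b) ⟨
      not (evalP I₁ A₁ φ (cast refl b)) ∎
      where
        open ≡-Reasoning
        p = arity σin S
        θ = updateSubst κ S
        ps = params p _
        φ = proj₂ (program R κ₀ S₀)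
        ψ = renameP (shift p refl) φ

    represents-step : Represents codeArity codes (expand I₁ A₁)
                        (λ R' b → eval I A' (dualProgram R' κ S) (a ++ᵛ b))
    represents-step R' = eval-dualFormula (decode codeArity codes R') _

  represents-run : ∀ {n} (α : List (Modification σin n)) I A A' →
                   Represents codeArity codes (expand I A) A' →
                   Represents codeArity codes
                     (expand (proj₁ (run program α (I , A))) (proj₂ (run program α (I , A))))
                     (proj₂ (run dualProgram α (I , A')))
  represents-run []              I A A' rep = rep
  represents-run (mod κ S a ∷ α) I A A' rep =
    represents-run α _ _ _ (represents-step I A A' rep κ S a)

  dualInit : ∀ n → Database σin n → Database σdual n
  dualInit n D R' b =
    expand D (init n D) (decode codeArity codes R') (cast (arity-decode codeArity codes R') b)

  dual : DynProgram σin σdual k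
  dual = record
    { program = dualProgram
    ; init    = dualInit
    ; qsym    = symOf (inj₁ qsym)
    ; qarity  = trans (sym (arity-symOf (inj₁ qsym))) qarity
    }

  dual-maintains : ∀ {𝒬} → Maintains 𝒫 𝒬 → Maintains dual 𝒬
  dual-maintains {𝒬} maintains n D α t = begin
    𝒬 n (applyMods α D) t
      ≡⟨ maintains n D α t ⟩
    proj₂ (run program α (D , init n D)) qsym t'
      ≡⟨ represents-encode codeArity {V = expand Dα Aα} {B = Aα'}
           (represents-run α D (init n D) (dualInit n D) (λ _ _ → refl))
           (codes-complete (inj₁ qsym)) t' ⟨
    Aα' (symOf (inj₁ qsym)) (cast (arity-symOf (inj₁ qsym)) t')
      ≡⟨ cong (Aα' (symOf (inj₁ qsym))) (cast-subst (arity-symOf (inj₁ qsym)) qarity t) ⟩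
    Aα' (symOf (inj₁ qsym)) (subst (Tuple n) (sym (DynProgram.qarity dual)) t) ∎
    where
      open ≡-Reasoning
      t' = subst (Tuple n) (sym qarity) t
      Dα = proj₁ (run program α (D , init n D))
      Aα = proj₂ (run program α (D , init n D))
      Aα' = proj₂ (run dualProgram α (D , dualInit n D))

dual-DynQFO : ∀ Q σin {k} (𝒬 : Query σin k) → DynQFO Q σin 𝒬 → DynQFO (dualPrefix Q) σin 𝒬
dual-DynQFO Q σin 𝒬 (σaux , 𝒫 , prefixes , maintains) =
  σdual , dual , dualProgram-prefix prefixes , dual-maintains {𝒬} maintains
  where open DualProgram 𝒫

lemma3p10 : (Q : List Quant) (σin : Schema) (k : ℕ) (𝒬 : Query σin k) →
            DynQFO Q σin 𝒬 ⇔ DynQFO (dualPrefix Q) σin 𝒬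
lemma3p10 Q σin k 𝒬 = mk⇔ (dual-DynQFO Q σin 𝒬) from-dual
  where
    from-dual : DynQFO (dualPrefix Q) σin 𝒬 → DynQFO Q σin 𝒬
    from-dual = subst (λ Q' → DynQFO Q' σin 𝒬) (dualPrefix-involutive Q)
              ∘ dual-DynQFO (dualPrefix Q) σin 𝒬
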